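{- For every lambda term $M$, context $\Gamma$, type $A$ and plug $\alpha$: if $\Gamma\vdash_{\cap}M:A$ in the intersection type assignment system for the lambda calculus, then $\llbracket M\rrbracket_\alpha:\Gamma\vdash\alpha{:}A$ is derivable in the intersection and union context assignment system for $\mathcal{X}$.
   Context: Lambda terms: $M,N::=x\mid\lambda x.M\mid MN$. Intersection types for the lambda calculus: $A,B::=\varphi\mid\top\mid A\Rightarrow B\mid A\cap B$; $\leq$ is the least preorder with $A\leq\top$, $A\cap B\leq A$, $A\cap B\leq B$, $C\leq A\ \&\ C\leq B\Rightarrow C\leq A\cap B$; $\sim$ is generated by $A\leq B\leq A\Rightarrow A\sim B$ and $A\sim C,B\sim D\Rightarrow A\Rightarrow B\sim C\Rightarrow D$; types are taken modulo $\sim$; $\bigcap_{i=1}^nA_i=A_1\cap\dots\cap A_n$ with the empty intersection equal to $\top$. A context $\Gamma$ is a finite partial map from term variables to types; $\Gamma,x{:}A$ denotes extension with $x\notin\Gamma$. $\Gamma\vdash_\cap M:A$ is derived by: (Ax) $\Gamma,x{:}A\vdash_\cap x:A$; ($\cap$I) for $n\geq0$, from $\Gamma\vdash_\cap M:A_j$ for all $j\leq n$ infer $\Gamma\vdash_\cap M:\bigcap_{i=1}^nA_i$; ($\cap$E) from $\Gamma\vdash_\cap M:\bigcap_{i=1}^nA_i$ infer $\Gamma\vdash_\cap M:A_j$ ($1\le j\le n$); ($\Rightarrow$I) from $\Gamma,x{:}A\vdash_\cap M:B$ infer $\Gamma\vdash_\cap\lambda x.M:A\Rightarrow B$; ($\Rightarrow$E)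 from $\Gamma\vdash_\cap M:A\Rightarrow B$ and $\Gamma\vdash_\cap N:A$ infer $\Gamma\vdash_\cap MN:B$. Nets of $\mathcal{X}$: with sockets $x,y,\dots$ (term variables serve as sockets) and plugs $\alpha,\beta,\dots$, $P,Q::=\langle x\cdot\alpha\rangle\mid\widehat{x}P\widehat{\beta}\cdot\alpha\mid P\widehat{\alpha}[y]\widehat{x}Q\mid P\widehat{\alpha}\dagger\widehat{x}Q$ (capsule, export, import, cut; hats mark bound names: $x,\beta$ bound in $P$ in an export; $\alpha$ bound in $P$ and $x$ in $Q$ in an import or cut). Translation: $\llbracket x\rrbracket_\alpha=\langle x\cdot\alpha\rangle$; $\llbracket\lambda x.M\rrbracket_\alpha=\widehat{x}\llbracket M\rrbracket_\beta\widehat{\beta}\cdot\alpha$; $\llbracket MN\rrbracket_\alpha=\llbracket M\rrbracket_\gamma\widehat{\gamma}\dagger\widehat{x}(\llbracket N\rrbracket_\beta\widehat{\beta}[x]\widehat{y}\langle y\cdot\alpha\rangle)$ with $x,y$ fresh. Types of $\mathcal{X}$: $A,B::=\varphi\mid\top\mid\bot\mid A\Rightarrow B\mid A\cap B\mid A\cup B$ modulo the equivalence induced by the least preorder $\leq$ extending the one above with $A,B\leq A\cup B$, $A,B\leq C\Rightarrow A\cup B\leq C$, $\bot\leq A$; empty union is $\bot$. Contexts of sockets $\Gamma$ and of plugs $\Delta$ are finite partial maps to types; $\Gamma\cap x{:}A$ replaces $x{:}B$ by $x{:}A\cap B$ or adds $x{:}A$; $\beta{:}A\cup\Delta$ analogous.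 Context assignment rules: (Ax) $\langle y\cdot\alpha\rangle:\Gamma,y{:}A\vdash\alpha{:}A,\Delta$; (cut) from $P:\Gamma\vdash\alpha{:}A,\Delta$ and $Q:\Gamma,x{:}A\vdash\Delta$ infer $P\widehat{\alpha}\dagger\widehat{x}Q:\Gamma\vdash\Delta$; ($\Rightarrow$L) from $P:\Gamma\vdash\alpha{:}A,\Delta$ and $Q:\Gamma,x{:}B\vdash\Delta$ infer $P\widehat{\alpha}[y]\widehat{x}Q:\Gamma\cap y{:}A\Rightarrow B\vdash\Delta$; ($\Rightarrow$R) from $P:\Gamma,x{:}A\vdash\alpha{:}B,\Delta$ infer $\widehat{x}P\widehat{\alpha}\cdot\beta:\Gamma\vdash\beta{:}A\Rightarrow B\cup\Delta$; ($\cap$R) for $n\ge0$, from $P:\Gamma\vdash\alpha{:}A_j,\Delta$ for all $j$ infer $P:\Gamma\vdash\alpha{:}\bigcap_{i=1}^nA_i,\Delta$; ($\cup$L) for $n\ge0$, from $P:\Gamma,x{:}A_j\vdash\Delta$ for all $j$ infer $P:\Gamma,x{:}\bigcup_{i=1}^nA_i\vdash\Delta$; ($\cap$E) from $P:\Gamma\vdash\alpha{:}\bigcap_{i=1}^nA_i,\Delta$ infer $P:\Gamma\vdash\alpha{:}A_j,\Delta$; ($\cup$E) from $P:\Gamma,x{:}\bigcup_{i=1}^nA_i\vdash\Delta$ infer $P:\Gamma,x{:}A_j\vdash\Delta$. -}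

module Defs where

open import Data.Nat using (ℕ; zero; suc; _≤_)
open import Data.Nat.Properties using (_≟_)
open import Data.Fin using (Fin; zero; suc)
open import Data.Maybe using (Maybe; just; nothing)
open import Data.List using (List; []; _∷_; _++_)
open import Data.Product using (∃; _×_)
open import Relation.Nullary using (yes; no; ¬_)
open import Relation.Binary.PropositionalEquality using (_≡_; _≢_)

-- Names.  Term variables double as sockets; plugs form a separate sort.

Var : Set
Var = ℕ

Plug : Set
Plug = ℕ

data Term : Set where
  var : Var → Term
  lam : Var → Term → Term
  app : Term → Term → Term

data FreeIn (x : Var) : Term → Set where
  fv-var  : FreeIn x (var x)
  fv-lam  : ∀ {y M} → x ≢ y → FreeIn x M → FreeIn x (lam y M)
  fv-appl : ∀ {M N} → FreeIn x M → FreeIn x (app M N)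
  fv-appr : ∀ {M N} → FreeIn x N → FreeIn x (app M N)

Map : Set → Set
Map T = ℕ → Maybe T

emptyMap : {T : Set} → Map T
emptyMap _ = nothing

upd : {T : Set} → Map T → ℕ → Maybe T → Map T
upd f x v k with k ≟ x
... | yes _ = v
... | no  _ = f k

-- Γ , x : A   (the rules add the side condition  Γ x ≡ nothing)
_,_∶_ : {T : Set} → Map T → ℕ → T → Map T
Γ , x ∶ A = upd Γ x (just A)

FiniteMap : {T : Set} → Map T → Set
FiniteMap Γ = ∃ λ n → ∀ k → n ≤ k → Γ k ≡ nothing

data MaybeRel {T : Set} (R : T → T → Set) : Maybe T → Maybe T → Set where
  nothing : MaybeRel R nothing nothing
  just    : ∀ {a b} → R a b → MaybeRel R (just a) (just b)

MapEq : {T : Set} → (T → T → Set) → Map T → Map T → Set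
MapEq R Γ Γ' = ∀ k → MaybeRel R (Γ k) (Γ' k)

infixr 7 _⇒_
infixl 8 _∩_

data LTy : Set where
  φ   : ℕ → LTy
  ⊤   : LTy
  _⇒_ : LTy → LTy → LTy
  _∩_ : LTy → LTy → LTy

data _≤ₗ_ : LTy → LTy → Set
data _~ₗ_ : LTy → LTy → Set

data _≤ₗ_ where
  ≤-refl  : ∀ {A} → A ≤ₗ A
  ≤-trans : ∀ {A B C} → A ≤ₗ B → B ≤ₗ C → A ≤ₗ C
  ≤-~     : ∀ {A B} → A ~ₗ B → A ≤ₗ B
  ≤-⊤     : ∀ {A} → A ≤ₗ ⊤
  ≤-∩l    : ∀ {A B} → (A ∩ B) ≤ₗ A
  ≤-∩r    : ∀ {A B} → (A ∩ B) ≤ₗ B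
  ≤-∩     : ∀ {A B C} → C ≤ₗ A → C ≤ₗ B → C ≤ₗ (A ∩ B)

data _~ₗ_ where
  ~-anti  : ∀ {A B} → A ≤ₗ B → B ≤ₗ A → A ~ₗ B
  ~-⇒     : ∀ {A B C D} → A ~ₗ C → B ~ₗ D → (A ⇒ B) ~ₗ (C ⇒ D)
  ~-refl  : ∀ {A} → A ~ₗ A
  ~-sym   : ∀ {A B} → A ~ₗ B → B ~ₗ A
  ~-trans : ∀ {A B C} → A ~ₗ B → B ~ₗ C → A ~ₗ C

⋂ : (n : ℕ) → (Fin n → LTy) → LTy
⋂ zero          A = ⊤
⋂ (suc zero)    A = A zero
⋂ (suc (suc n)) A = A zero ∩ ⋂ (suc n) (λ i → A (suc i))

LCtx : Set
LCtx = Map LTy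

-- Γ ⊢∩ M : A   (types and contexts taken modulo ~ : rule conv)
data _⊢∩_∶_ : LCtx → Term → LTy → Set where
  ax   : ∀ {Γ x A} → Γ x ≡ just A → Γ ⊢∩ var x ∶ A
  ∩I   : ∀ {Γ M} (n : ℕ) (A : Fin n → LTy) →
         (∀ j → Γ ⊢∩ M ∶ A j) → Γ ⊢∩ M ∶ ⋂ n A
  ∩E   : ∀ {Γ M} (n : ℕ) (A : Fin n → LTy) (j : Fin n) →
         Γ ⊢∩ M ∶ ⋂ n A → Γ ⊢∩ M ∶ A j
  ⇒I   : ∀ {Γ x M A B} → Γ x ≡ nothing →
         (Γ , x ∶ A) ⊢∩ M ∶ B → Γ ⊢∩ lam x M ∶ (A ⇒ B)
  ⇒E   : ∀ {Γ M N A B} → Γ ⊢∩ M ∶ (A ⇒ B) → Γ ⊢∩ N ∶ A → Γ ⊢∩ app M N ∶ B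
  conv : ∀ {Γ Γ' M A A'} → MapEq _~ₗ_ Γ Γ' → A ~ₗ A' →
         Γ ⊢∩ M ∶ A → Γ' ⊢∩ M ∶ A'

data Net : Set where
  ⟨_·_⟩ : Var → Plug → Net
  exp   : Var → Net → Plug → Plug → Net          -- exp x P β α  =  x̂ P β̂ · α
  imp   : Net → Plug → Var → Var → Net → Net     -- imp P α y x Q = P α̂ [y] x̂ Q
  cut   : Net → Plug → Var → Net → Net           -- cut P α x Q   = P α̂ † x̂ Q

boundSockets : Net → List Var
boundSockets ⟨ x · α ⟩     = []
boundSockets (exp x P β α) = x ∷ boundSockets P
boundSockets (imp P α y x Q) = boundSockets P ++ (x ∷ boundSockets Q)
boundSockets (cut P α x Q) = boundSockets P ++ (x ∷ boundSockets Q)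

boundPlugs : Net → List Plug
boundPlugs ⟨ x · α ⟩       = []
boundPlugs (exp x P β α)   = β ∷ boundPlugs P
boundPlugs (imp P α y x Q) = α ∷ (boundPlugs P ++ boundPlugs Q)
boundPlugs (cut P α x Q)   = α ∷ (boundPlugs P ++ boundPlugs Q)

-- Translation ⟦M⟧_α ⇝ P  (a relation, since x,y are any fresh names and
-- the bound plugs are arbitrary)
data Tr : Term → Plug → Net → Set where
  tr-var : ∀ {x α} → Tr (var x) α ⟨ x · α ⟩
  tr-lam : ∀ {x M α β P} → Tr M β P → Tr (lam x M) α (exp x P β α)
  tr-app : ∀ {M N α γ β x y P Q} →
           x ≢ y →
           ¬ FreeIn x (app M N) → ¬ FreeIn y (app M N) →
           Tr M γ P → Tr N β Q →
           Tr (app M N) α (cut P γ x (imp Q β x y ⟨ y · α ⟩))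

infixr 7 _⇒ˣ_
infixl 8 _∩ˣ_
infixl 8 _∪ˣ_

data XTy : Set where
  φˣ   : ℕ → XTy
  ⊤ˣ   : XTy
  ⊥ˣ   : XTy
  _⇒ˣ_ : XTy → XTy → XTy
  _∩ˣ_ : XTy → XTy → XTy
  _∪ˣ_ : XTy → XTy → XTy

data _≤ˣ_ : XTy → XTy → Set
data _~ˣ_ : XTy → XTy → Set

data _≤ˣ_ where
  ≤-refl  : ∀ {A} → A ≤ˣ A
  ≤-trans : ∀ {A B C} → A ≤ˣ B → B ≤ˣ C → A ≤ˣ C
  ≤-~     : ∀ {A B} → A ~ˣ B → A ≤ˣ B
  ≤-⊤     : ∀ {A} → A ≤ˣ ⊤ˣ
  ≤-∩l    : ∀ {A B} → (A ∩ˣ B) ≤ˣ A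
  ≤-∩r    : ∀ {A B} → (A ∩ˣ B) ≤ˣ B
  ≤-∩     : ∀ {A B C} → C ≤ˣ A → C ≤ˣ B → C ≤ˣ (A ∩ˣ B)
  ≤-∪l    : ∀ {A B} → A ≤ˣ (A ∪ˣ B)
  ≤-∪r    : ∀ {A B} → B ≤ˣ (A ∪ˣ B)
  ≤-∪     : ∀ {A B C} → A ≤ˣ C → B ≤ˣ C → (A ∪ˣ B) ≤ˣ C
  ≤-⊥     : ∀ {A} → ⊥ˣ ≤ˣ A

data _~ˣ_ where
  ~-anti  : ∀ {A B} → A ≤ˣ B → B ≤ˣ A → A ~ˣ B
  ~-⇒     : ∀ {A B C D} → A ~ˣ C → B ~ˣ D → (A ⇒ˣ B) ~ˣ (C ⇒ˣ D)
  ~-refl  : ∀ {A} → A ~ˣ A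
  ~-sym   : ∀ {A B} → A ~ˣ B → B ~ˣ A
  ~-trans : ∀ {A B C} → A ~ˣ B → B ~ˣ C → A ~ˣ C

⋂ˣ : (n : ℕ) → (Fin n → XTy) → XTy
⋂ˣ zero          A = ⊤ˣ
⋂ˣ (suc zero)    A = A zero
⋂ˣ (suc (suc n)) A = A zero ∩ˣ ⋂ˣ (suc n) (λ i → A (suc i))

⋃ˣ : (n : ℕ) → (Fin n → XTy) → XTy
⋃ˣ zero          A = ⊥ˣ
⋃ˣ (suc zero)    A = A zero
⋃ˣ (suc (suc n)) A = A zero ∪ˣ ⋃ˣ (suc n) (λ i → A (suc i))

Ctx : Set
Ctx = Map XTy

meetAt : Ctx → Var → XTy → Ctx
meetAt Γ x A with Γ x
... | nothing = Γ , x ∶ A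
... | just B  = Γ , x ∶ (A ∩ˣ B)

joinAt : Ctx → Plug → XTy → Ctx
joinAt Δ β A with Δ β
... | nothing = Δ , β ∶ A
... | just B  = Δ , β ∶ (A ∪ˣ B)

-- P : Γ ⊢ Δ  (types and contexts taken modulo ~ : rule conv)
data _∶_⊢_ : Net → Ctx → Ctx → Set where
  ax   : ∀ {Γ Δ y α A} → Γ y ≡ just A → Δ α ≡ just A → ⟨ y · α ⟩ ∶ Γ ⊢ Δ
  cut  : ∀ {Γ Δ P Q α x A} → Δ α ≡ nothing → Γ x ≡ nothing →
         P ∶ Γ ⊢ (Δ , α ∶ A) → Q ∶ (Γ , x ∶ A) ⊢ Δ →
         cut P α x Q ∶ Γ ⊢ Δ
  ⇒L   : ∀ {Γ Δ P Q α x y A B} → Δ α ≡ nothing → Γ x ≡ nothing →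
         P ∶ Γ ⊢ (Δ , α ∶ A) → Q ∶ (Γ , x ∶ B) ⊢ Δ →
         imp P α y x Q ∶ meetAt Γ y (A ⇒ˣ B) ⊢ Δ
  ⇒R   : ∀ {Γ Δ P α β x A B} → Γ x ≡ nothing → Δ α ≡ nothing →
         P ∶ (Γ , x ∶ A) ⊢ (Δ , α ∶ B) →
         exp x P α β ∶ Γ ⊢ joinAt Δ β (A ⇒ˣ B)
  ∩R   : ∀ {Γ Δ P α} (n : ℕ) (A : Fin n → XTy) → Δ α ≡ nothing →
         (∀ j → P ∶ Γ ⊢ (Δ , α ∶ A j)) → P ∶ Γ ⊢ (Δ , α ∶ ⋂ˣ n A)
  ∪L   : ∀ {Γ Δ P x} (n : ℕ) (A : Fin n → XTy) → Γ x ≡ nothing →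
         (∀ j → P ∶ (Γ , x ∶ A j) ⊢ Δ) → P ∶ (Γ , x ∶ ⋃ˣ n A) ⊢ Δ
  ∩E   : ∀ {Γ Δ P α} (n : ℕ) (A : Fin n → XTy) (j : Fin n) → Δ α ≡ nothing →
         P ∶ Γ ⊢ (Δ , α ∶ ⋂ˣ n A) → P ∶ Γ ⊢ (Δ , α ∶ A j)
  ∪E   : ∀ {Γ Δ P x} (n : ℕ) (A : Fin n → XTy) (j : Fin n) → Γ x ≡ nothing →
         P ∶ (Γ , x ∶ ⋃ˣ n A) ⊢ Δ → P ∶ (Γ , x ∶ A j) ⊢ Δ
  conv : ∀ {Γ Γ' Δ Δ' P} → MapEq _~ˣ_ Γ Γ' → MapEq _~ˣ_ Δ Δ' →
         P ∶ Γ ⊢ Δ → P ∶ Γ' ⊢ Δ'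

ι : LTy → XTy
ι (φ n)   = φˣ n
ι ⊤       = ⊤ˣ
ι (A ⇒ B) = ι A ⇒ˣ ι B
ι (A ∩ B) = ι A ∩ˣ ι B

ιCtx : LCtx → Ctx
ιCtx Γ k with Γ k
... | nothing = nothing
... | just A  = just (ι A)

[_∶_] : Plug → XTy → Ctx
[ α ∶ A ] = emptyMap , α ∶ A

-- Induction on the derivation of Γ ⊢∩ M : A, generalised to an arbitrary plug
-- context Δ next to α, since both subnets of an application output into the
-- context Δ , α : B of the whole net.  The rules ∩I, ∩E, ⇒I become ∩R, ∩E, ⇒R,
-- and ⇒E becomes a cut against the import of the argument into ⟨y·α⟩.  The
-- merges Γ ∩ y:A⇒B and β:A⇒B ∪ Δ in ⇒L and ⇒R are plain extensions here,
-- because the names involved are bound in the net and hence fresh.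
module Submission where

open import Defs
open import Data.List.Membership.Propositional using (_∉_)
open import Data.List.Relation.Unary.All using (All)
open import Data.List.Relation.Unary.Unique.Propositional using (Unique)
open import Data.Maybe using (nothing)
open import Relation.Binary.PropositionalEquality using (_≡_)

open import Data.Nat using (ℕ; suc; _≟_)
open import Data.Fin using (Fin; zero; suc)
open import Data.Maybe using (Maybe; just)
open import Data.List using (List; []; _∷_; _++_)
open import Data.Product using (_×_; _,_; proj₁)
open import Data.Empty using (⊥-elim)
open import Function using (_∘_)
open import Relation.Nullary using (yes; no)
open import Relation.Binary.PropositionalEquality using (refl; sym; trans; cong; subst; _≢_)
open import Data.List.Relation.Unary.All using ([]; _∷_)
import Data.List.Relation.Unary.All as All
import Data.List.Relation.Unary.All.Properties as All
open import Data.List.Relation.Unary.AllPairs using (AllPairs; []; _∷_)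

private
  variable
    T : Set
    R : T → T → Set
    Γ Γ′ Δ : Map T
    x y : ℕ
    xs : List ℕ

upd-here : (f : Map T) (x : ℕ) (v : Maybe T) → upd f x v x ≡ v
upd-here f x v with x ≟ x
... | yes _ = refl
... | no x≢x = ⊥-elim (x≢x refl)

upd-there : (f : Map T) (x : ℕ) (v : Maybe T) → y ≢ x → upd f x v y ≡ f y
upd-there {y = y} f x v y≢x with y ≟ x
... | yes y≡x = ⊥-elim (y≢x y≡x)
... | no _ = refl

MaybeRel-refl : (∀ {a} → R a a) → (m : Maybe T) → MaybeRel R m m
MaybeRel-refl r nothing = nothing
MaybeRel-refl r (just _) = just r

MapEq-refl : (∀ {a} → R a a) → MapEq R Γ Γ
MapEq-refl {Γ = Γ} r k = MaybeRel-refl r (Γ k)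

MapEq-, : ∀ {a b} → MapEq R Γ Γ′ → R a b → MapEq R (Γ , x ∶ a) (Γ′ , x ∶ b)
MapEq-, {x = x} Γ≈Γ′ a≈b k with k ≟ x
... | yes _ = just a≈b
... | no _ = Γ≈Γ′ k

MapEq-fresh : MapEq R Γ Γ′ → Γ′ x ≡ nothing → Γ x ≡ nothing
MapEq-fresh {Γ = Γ} {Γ′ = Γ′} {x = x} Γ≈Γ′ Γ′x with Γ x | Γ′ x | Γ≈Γ′ x
... | nothing | _ | _ = refl
MapEq-fresh _ () | just _ | just _ | just _

meetAt-fresh : ∀ {Γ : Ctx} {A} → Γ x ≡ nothing → meetAt Γ x A ≡ (Γ , x ∶ A)
meetAt-fresh {x = x} {Γ = Γ} Γx with Γ x
meetAt-fresh refl | nothing = refl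

joinAt-fresh : ∀ {Δ : Ctx} {A} → Δ x ≡ nothing → joinAt Δ x A ≡ (Δ , x ∶ A)
joinAt-fresh {x = x} {Δ = Δ} Δx with Δ x
joinAt-fresh refl | nothing = refl

AllPairs-++⁻ : ∀ (xs : List T) {ys} → AllPairs R (xs ++ ys) → AllPairs R xs × AllPairs R ys
AllPairs-++⁻ [] rs = [] , rs
AllPairs-++⁻ (x ∷ xs) (r ∷ rs) =
  let (rxs , rys) = AllPairs-++⁻ xs rs in All.++⁻ˡ xs r ∷ rxs , rys

Fresh : Map T → List ℕ → Set
Fresh Γ xs = Unique xs × All (λ x → Γ x ≡ nothing) xs

Fresh-head : Fresh Γ (x ∷ xs) → Γ x ≡ nothing
Fresh-head (_ , Γx ∷ _) = Γx

Fresh-tail : Fresh Γ (x ∷ xs) → Fresh Γ xs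
Fresh-tail (_ ∷ u , _ ∷ f) = u , f

Fresh-++⁻ : ∀ xs {ys} → Fresh Γ (xs ++ ys) → Fresh Γ xs × Fresh Γ ys
Fresh-++⁻ xs (u , f) =
  let (uxs , uys) = AllPairs-++⁻ xs u
      (fxs , fys) = All.++⁻ xs f
  in (uxs , fxs) , (uys , fys)

Fresh-extend : ∀ {A} → Fresh Γ (x ∷ xs) → Fresh (Γ , x ∶ A) xs
Fresh-extend {Γ = Γ} {x = x} {A = A} (x∉xs ∷ u , _ ∷ f) =
  u , All.map (λ {z} (x≢z , Γz) → trans (upd-there Γ x (just A) (x≢z ∘ sym)) Γz)
              (All.zip (x∉xs , f))

Fresh-resp-MapEq : MapEq R Γ Γ′ → Fresh Γ′ xs → Fresh Γ xs
Fresh-resp-MapEq Γ≈Γ′ (u , f) = u , All.map (MapEq-fresh Γ≈Γ′) f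

ι-mono : ∀ {A B} → A ≤ₗ B → ι A ≤ˣ ι B
ι-cong : ∀ {A B} → A ~ₗ B → ι A ~ˣ ι B
ι-mono ≤-refl = ≤-refl
ι-mono (≤-trans A≤B B≤C) = ≤-trans (ι-mono A≤B) (ι-mono B≤C)
ι-mono (≤-~ A~B) = ≤-~ (ι-cong A~B)
ι-mono ≤-⊤ = ≤-⊤
ι-mono ≤-∩l = ≤-∩l
ι-mono ≤-∩r = ≤-∩r
ι-mono (≤-∩ C≤A C≤B) = ≤-∩ (ι-mono C≤A) (ι-mono C≤B)
ι-cong (~-anti A≤B B≤A) = ~-anti (ι-mono A≤B) (ι-mono B≤A)
ι-cong (~-⇒ A~C B~D) = ~-⇒ (ι-cong A~C) (ι-cong B~D)
ι-cong ~-refl = ~-refl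
ι-cong (~-sym A~B) = ~-sym (ι-cong A~B)
ι-cong (~-trans A~B B~C) = ~-trans (ι-cong A~B) (ι-cong B~C)

ι-⋂ : ∀ n (A : Fin n → LTy) → ι (⋂ n A) ≡ ⋂ˣ n (ι ∘ A)
ι-⋂ 0 A = refl
ι-⋂ 1 A = refl
ι-⋂ (suc (suc n)) A = cong (ι (A zero) ∩ˣ_) (ι-⋂ (suc n) (A ∘ suc))

ιCtx-fresh : ∀ (Γ : LCtx) → Γ x ≡ nothing → ιCtx Γ x ≡ nothing
ιCtx-fresh {x = x} Γ Γx with Γ x
ιCtx-fresh Γ refl | nothing = refl

ιCtx-bound : ∀ (Γ : LCtx) {A} → Γ x ≡ just A → ιCtx Γ x ≡ just (ι A)
ιCtx-bound {x = x} Γ Γx with Γ x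
ιCtx-bound Γ refl | just _ = refl

ιCtx-, : ∀ (Γ : LCtx) {A} → MapEq _~ˣ_ (ιCtx (Γ , x ∶ A)) (ιCtx Γ , x ∶ ι A)
ιCtx-, {x = x} Γ k with k ≟ x
... | yes _ = just ~-refl
... | no _ = MaybeRel-refl ~-refl (ιCtx Γ k)

ιCtx-cong : ∀ {Γ Γ′ : LCtx} → MapEq _~ₗ_ Γ Γ′ → MapEq _~ˣ_ (ιCtx Γ) (ιCtx Γ′)
ιCtx-cong {Γ = Γ} {Γ′ = Γ′} Γ≈Γ′ k with Γ k | Γ′ k | Γ≈Γ′ k
... | nothing | nothing | nothing = nothing
... | just _ | just _ | just A~B = just (ι-cong A~B)

exp-⊢ : ∀ {Γ Δ : Ctx} {P α β A B} → Γ x ≡ nothing → Δ α ≡ nothing → Δ β ≡ nothing →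
        P ∶ (Γ , x ∶ A) ⊢ (Δ , β ∶ B) → exp x P β α ∶ Γ ⊢ (Δ , α ∶ (A ⇒ˣ B))
exp-⊢ {x = x} {Γ = Γ} {P = P} {α} {β} Γx Δα Δβ ⊢P =
  subst (λ Δ′ → exp x P β α ∶ Γ ⊢ Δ′) (joinAt-fresh Δα) (⇒R Γx Δβ ⊢P)

app-⊢ : ∀ {Γ Δ : Ctx} {P Q α β γ A B} →
        Γ x ≡ nothing → Γ y ≡ nothing → (Δ , α ∶ B) γ ≡ nothing → (Δ , α ∶ B) β ≡ nothing →
        P ∶ Γ ⊢ ((Δ , α ∶ B) , γ ∶ (A ⇒ˣ B)) → Q ∶ Γ ⊢ ((Δ , α ∶ B) , β ∶ A) →
        cut P γ x (imp Q β x y ⟨ y · α ⟩) ∶ Γ ⊢ (Δ , α ∶ B)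
app-⊢ {x = x} {y = y} {Γ = Γ} {Δ} {Q = Q} {α} {β} {B = B} Γx Γy Δγ Δβ ⊢P ⊢Q =
  cut Δγ Γx ⊢P (subst (λ Γ′ → imp Q β x y ⟨ y · α ⟩ ∶ Γ′ ⊢ (Δ , α ∶ B)) (meetAt-fresh Γx)
                  (⇒L Δβ Γy ⊢Q capsule))
  where
    capsule : ⟨ y · α ⟩ ∶ (Γ , y ∶ B) ⊢ (Δ , α ∶ B)
    capsule = ax (upd-here Γ y _) (upd-here Δ α _)

translation-⊢ : ∀ {Γ M A α P} (Δ : Ctx) → Tr M α P →
                Fresh Γ (boundSockets P) → Fresh Δ (α ∷ boundPlugs P) →
                Γ ⊢∩ M ∶ A → P ∶ ιCtx Γ ⊢ (Δ , α ∶ ι A)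
translation-⊢ {Γ} {α = α} Δ tr-var _ _ (ax Γx) = ax (ιCtx-bound Γ Γx) (upd-here Δ α _)
translation-⊢ Δ tr sockets plugs (∩I n A ⊢M) rewrite ι-⋂ n A =
  ∩R n (ι ∘ A) (Fresh-head plugs) (λ j → translation-⊢ Δ tr sockets plugs (⊢M j))
translation-⊢ {α = α} {P} Δ tr sockets plugs (∩E n A j ⊢M) =
  ∩E n (ι ∘ A) j (Fresh-head plugs)
    (subst (λ B → P ∶ _ ⊢ (Δ , α ∶ B)) (ι-⋂ n A) (translation-⊢ Δ tr sockets plugs ⊢M))
translation-⊢ {Γ} Δ (tr-lam tr) sockets plugs (⇒I _ ⊢M) =
  exp-⊢ (ιCtx-fresh Γ (Fresh-head sockets)) (Fresh-head plugs) (Fresh-head (Fresh-tail plugs))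
    (conv (ιCtx-, Γ) (MapEq-refl ~-refl)
      (translation-⊢ Δ tr (Fresh-extend sockets) (Fresh-tail plugs) ⊢M))
translation-⊢ {Γ} Δ (tr-app {γ = γ} {β} {P = P} {Q} _ _ _ trM trN) sockets plugs (⇒E ⊢M ⊢N) =
  let (socketsM , socketsRest) = Fresh-++⁻ (boundSockets P) sockets
      (socketsN , socketsY)    = Fresh-++⁻ (boundSockets Q) (Fresh-tail socketsRest)
      (plugsM , plugsRest)     = Fresh-++⁻ (γ ∷ boundPlugs P) (Fresh-extend plugs)
      plugsN                   = proj₁ (Fresh-++⁻ (β ∷ boundPlugs Q) plugsRest)
  in app-⊢ (ιCtx-fresh Γ (Fresh-head socketsRest)) (ιCtx-fresh Γ (Fresh-head socketsY))
           (Fresh-head plugsM) (Fresh-head plugsN)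
           (translation-⊢ _ trM socketsM plugsM ⊢M) (translation-⊢ _ trN socketsN plugsN ⊢N)
translation-⊢ {α = α} Δ tr sockets plugs (conv Γ≈Γ′ A~A′ ⊢M) =
  conv (ιCtx-cong Γ≈Γ′) (MapEq-, {x = α} (MapEq-refl ~-refl) (ι-cong A~A′))
    (translation-⊢ Δ tr (Fresh-resp-MapEq Γ≈Γ′ sockets) plugs ⊢M)

mainTheorem4 : (M : Term) (Γ : LCtx) (A : LTy) (α : Plug) (P : Net)
    → FiniteMap Γ
    → Tr M α P
    → Unique (boundSockets P)
    → All (λ x → Γ x ≡ nothing) (boundSockets P)
    → Unique (boundPlugs P)
    → α ∉ boundPlugs P
    → Γ ⊢∩ M ∶ A
    → P ∶ ιCtx Γ ⊢ [ α ∶ ι A ]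
mainTheorem4 M Γ A α P _ tr socketsUnique socketsFree plugsUnique α∉plugs ⊢M =
  translation-⊢ emptyMap tr (socketsUnique , socketsFree)
    (All.¬Any⇒All¬ _ α∉plugs ∷ plugsUnique , All.universal (λ _ → refl) _) ⊢M
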